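{- Let $A$ be a formula in the language of Rational Pavelka logic $\mathsf{RPL}$ (i.e. containing no justification assertions $t:B$), and let $\mathsf{CS}$ be a constant specification. If $A$ is provable in $\mathsf{RPLJ}_{\mathsf{CS}}$, then $A$ is provable in $\mathsf{RPL}$.
   Context: Justification terms are built from justification variables $x_1,x_2,\dots$ and justification constants $c,c_1,c_2,\dots$ by binary operations $\cdot$ and $+$. Formulas of $\mathsf{RPLJ}$: $A::=p\mid\bar r\mid A\&A\mid A\to A\mid t:A$ ($p$ a propositional variable, $r\in\mathbb Q\cap[0,1]$, $t$ a term); formulas of $\mathsf{RPL}$ are those built without $t:A$. Abbreviations: $\neg A:=A\to\bar0$, $A\wedge B:=A\&(A\to B)$, $A\equiv B:=(A\to B)\&(B\to A)$, $t\overset{r}{:}A:=(\bar r\to t:A)\wedge(t:A\to\bar r)$. On $[0,1]$: $x*_Ly=\max(0,x+y-1)$, $x\Rightarrow_Ly=\min(1,1-x+y)$. $\mathsf{RPL}$ has the axiom schemes (BL1) $(A\to B)\to((B\to C)\to(A\to C))$; (BL2) $(A\&B)\to A$; (BL3) $(A\&B)\to(B\&A)$; (BL4) $(A\&(A\to B))\to(B\&(B\to A))$; (BL5a) $(A\to(B\to C))\to((A\&B)\to C)$; (BL5b) $((A\&B)\to C)\to(A\to(B\to C))$; (BL6) $((A\to B)\to C)\to(((B\to A)\to C)\to C)$; (BL7) $\bar0\to A$; (L) $\neg\neg A\to A$; (TC1) $(\bar r\to\bar{r'})\equiv\overline{r\Rightarrow_Lr'}$; (TC2) $(\bar r\&\bar{r'})\equiv\overline{r*_Lr'}$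 (for all rationals $r,r'\in[0,1]$), restricted to $\mathsf{RPL}$-formulas, and the rule Modus Ponens. $\mathsf{RPLJ}$ has the same schemes over all $\mathsf{RPLJ}$-formulas plus (Appl) $s:(A\to B)\to(t:A\to(s\cdot t):B)$ and (Sum) $s:A\to(s+t):A$, $s:A\to(t+s):A$. A constant specification $\mathsf{CS}$ is a downward closed set of formulas $c_{i_n}\overset{1}{:}\cdots\overset{1}{:}c_{i_1}\overset{1}{:}A$ ($n\ge1$, $c_{i_j}$ constants, $A$ an axiom instance of $\mathsf{RPLJ}$) (with such a formula, $n\ge2$, it contains $c_{i_{n-1}}\overset1:\cdots\overset1:c_{i_1}\overset1:A$). $\mathsf{RPLJ}_{\mathsf{CS}}$ has the axioms of $\mathsf{RPLJ}$ and the rules Modus Ponens and "derive any member of $\mathsf{CS}$". -}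

module Defs where

open import Data.Nat using (ℕ)
open import Data.Rational using (ℚ; 0ℚ; 1ℚ; _+_; _-_; _⊔_; _⊓_; _≤_)
open import Data.Rational.Properties using (p≤p⊔q; ⊔-lub; p⊓q≤p; ≤-refl)
open import Data.List using (List; []; _∷_)
open import Data.Product using (Σ; ∃; _×_; _,_)
open import Relation.Binary.PropositionalEquality using (_≡_)

record Q01 : Set where
  constructor q01
  field
    val : ℚ
    .lo : 0ℚ ≤ val
    .hi : val ≤ 1ℚ
open Q01 public

private
  0≤1 : 0ℚ ≤ 1ℚ
  0≤1 = p≤p⊔q 0ℚ 1ℚ

clamp : ℚ → Q01
clamp x = q01 (0ℚ ⊔ (1ℚ ⊓ x)) (p≤p⊔q 0ℚ (1ℚ ⊓ x)) (⊔-lub 0≤1 (p⊓q≤p 1ℚ x))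

-- Łukasiewicz operations.  For x, y ∈ [0,1]:
--   x *L y  = max(0, x + y - 1)  = clamp (x + y - 1)
--   x ⇒L y = min(1, 1 - x + y)  = clamp (1 - x + y)
_*L_ : Q01 → Q01 → Q01
r *L s = clamp ((val r + val s) - 1ℚ)

_⇒L_ : Q01 → Q01 → Q01
r ⇒L s = clamp ((1ℚ - val r) + val s)

module Core {F : Set} (_&_ : F → F → F) (_⇒_ : F → F → F) (cnst : Q01 → F) where

  ⊥F : F
  ⊥F = cnst (q01 0ℚ (p≤p⊔q 0ℚ 0ℚ) 0≤1)

  ¬F : F → F
  ¬F A = A ⇒ ⊥F

  _∧_ : F → F → F
  A ∧ B = A & (A ⇒ B)

  _≡F_ : F → F → F
  A ≡F B = (A ⇒ B) & (B ⇒ A)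

  data Ax : F → Set where
    BL1 : ∀ A B C → Ax ((A ⇒ B) ⇒ ((B ⇒ C) ⇒ (A ⇒ C)))
    BL2 : ∀ A B → Ax ((A & B) ⇒ A)
    BL3 : ∀ A B → Ax ((A & B) ⇒ (B & A))
    BL4 : ∀ A B → Ax ((A & (A ⇒ B)) ⇒ (B & (B ⇒ A)))
    BL5a : ∀ A B C → Ax ((A ⇒ (B ⇒ C)) ⇒ ((A & B) ⇒ C))
    BL5b : ∀ A B C → Ax (((A & B) ⇒ C) ⇒ (A ⇒ (B ⇒ C)))
    BL6 : ∀ A B C → Ax (((A ⇒ B) ⇒ C) ⇒ (((B ⇒ A) ⇒ C) ⇒ C))
    BL7 : ∀ A → Ax (⊥F ⇒ A)
    L : ∀ A → Ax (¬F (¬F A) ⇒ A)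
    TC1 : ∀ r s → Ax ((cnst r ⇒ cnst s) ≡F cnst (r ⇒L s))
    TC2 : ∀ r s → Ax ((cnst r & cnst s) ≡F cnst (r *L s))

data PFm : Set where
  pvar : ℕ → PFm
  cst  : Q01 → PFm
  _&_  : PFm → PFm → PFm
  _⇒_  : PFm → PFm → PFm

module RPLCore = Core {PFm} _&_ _⇒_ cst

data RPL⊢_ : PFm → Set where
  ax : ∀ {A} → RPLCore.Ax A → RPL⊢ A
  mp : ∀ {A B} → RPL⊢ (A ⇒ B) → RPL⊢ A → RPL⊢ B

data Tm : Set where
  jvar : ℕ → Tm
  jcon : ℕ → Tm
  _·_  : Tm → Tm → Tm
  _⊕_  : Tm → Tm → Tm

data Fm : Set where
  pvar : ℕ → Fm
  cst  : Q01 → Fm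
  _&_  : Fm → Fm → Fm
  _⇒_  : Fm → Fm → Fm
  _∶_  : Tm → Fm → Fm

module RPLJCore = Core {Fm} _&_ _⇒_ cst
open RPLJCore using (_∧_) renaming (Ax to BLAx)

data AxJ : Fm → Set where
  core : ∀ {A} → BLAx A → AxJ A
  Appl : ∀ s t A B → AxJ ((s ∶ (A ⇒ B)) ⇒ ((t ∶ A) ⇒ ((s · t) ∶ B)))
  SumL : ∀ s t A → AxJ ((s ∶ A) ⇒ ((s ⊕ t) ∶ A))
  SumR : ∀ s t A → AxJ ((s ∶ A) ⇒ ((t ⊕ s) ∶ A))

_∶[_]_ : Tm → Q01 → Fm → Fm
t ∶[ r ] A = (cst r ⇒ (t ∶ A)) ∧ ((t ∶ A) ⇒ cst r)

one : Q01
one = q01 1ℚ 0≤1 ≤-refl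

-- chain (c_{i_n} ∷ … ∷ c_{i_1} ∷ []) A = c_{i_n} :¹ … :¹ c_{i_1} :¹ A
chain : List ℕ → Fm → Fm
chain [] A = A
chain (c ∷ cs) A = jcon c ∶[ one ] chain cs A

record CS : Set₁ where
  field
    mem : Fm → Set
    shape : ∀ F → mem F →
            Σ ℕ λ c → Σ (List ℕ) λ cs → Σ Fm λ A →
              AxJ A × F ≡ chain (c ∷ cs) A
    down : ∀ c c' cs A → AxJ A → mem (chain (c ∷ c' ∷ cs) A) → mem (chain (c' ∷ cs) A)
open CS public

data _⊢J_ (𝒞 : CS) : Fm → Set where
  ax  : ∀ {A} → AxJ A → 𝒞 ⊢J A
  mp  : ∀ {A B} → 𝒞 ⊢J (A ⇒ B) → 𝒞 ⊢J A → 𝒞 ⊢J B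
  csr : ∀ {A} → mem 𝒞 A → 𝒞 ⊢J A

emb : PFm → Fm
emb (pvar p) = pvar p
emb (cst r) = cst r
emb (A & B) = emb A & emb B
emb (A ⇒ B) = emb A ⇒ emb B

module Submission where

-- The map `erase` replaces every justification assertion t : B by the truth
-- constant 1̄ and is the identity on the RPL connectives.  We show that it
-- sends every theorem of RPLJ_CS to a theorem of RPL:
--   * instances of the BL/Ł/truth-constant schemes go to instances of the
--     same schemes;
--   * (Appl) and (Sum) go to 1̄ → (1̄ → 1̄) and 1̄ → 1̄;
--   * members of CS, c :¹ B, go to (1̄ → 1̄) ∧ (1̄ → 1̄);
--   * Modus Ponens commutes with erasure.  Since
-- erasure fixes RPL formulas, the theorem follows.

open import Defs
open import Data.Product using (_,_)
open import Relation.Binary.PropositionalEquality using (_≡_; refl; cong₂; subst)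

open RPLCore renaming (Ax to RPLAx)

⇒-trans : ∀ {A B C} → RPL⊢ (A ⇒ B) → RPL⊢ (B ⇒ C) → RPL⊢ (A ⇒ C)
⇒-trans p q = mp (mp (ax (BL1 _ _ _)) p) q

weaken : ∀ A B → RPL⊢ (A ⇒ (B ⇒ A))
weaken A B = mp (ax (BL5b _ _ _)) (ax (BL2 A B))

&-refl : ∀ A B → RPL⊢ ((A & B) ⇒ (A & B))
&-refl A B = ⇒-trans (ax (BL3 A B)) (ax (BL3 B A))

-- Reflexivity of →.  From (B & A) → A we get B → (A → A) by BL5b; any
-- provable B, e.g. an instance of &-refl, then discharges the premise.
⇒-refl : ∀ A → RPL⊢ (A ⇒ A)
⇒-refl A = mp (mp (ax (BL5b _ _ _)) (⇒-trans (ax (BL3 B A)) (ax (BL2 A B)))) (&-refl C C)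
  where
    C : PFm
    C = pvar 0
    B : PFm
    B = (C & C) ⇒ (C & C)

&-intro : ∀ {A B} → RPL⊢ A → RPL⊢ B → RPL⊢ (A & B)
&-intro p q = mp (mp (mp (ax (BL5b _ _ _)) (&-refl _ _)) p) q

erase : Fm → PFm
erase (pvar p) = pvar p
erase (cst r) = cst r
erase (A & B) = erase A & erase B
erase (A ⇒ B) = erase A ⇒ erase B
erase (t ∶ A) = cst one

erase-emb : ∀ A → erase (emb A) ≡ A
erase-emb (pvar p) = refl
erase-emb (cst r) = refl
erase-emb (A & B) = cong₂ _&_ (erase-emb A) (erase-emb B)
erase-emb (A ⇒ B) = cong₂ _⇒_ (erase-emb A) (erase-emb B)

erase-core : ∀ {A} → RPLJCore.Ax A → RPLAx (erase A)
erase-core (RPLJCore.BL1 A B C) = BL1 _ _ _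
erase-core (RPLJCore.BL2 A B) = BL2 _ _
erase-core (RPLJCore.BL3 A B) = BL3 _ _
erase-core (RPLJCore.BL4 A B) = BL4 _ _
erase-core (RPLJCore.BL5a A B C) = BL5a _ _ _
erase-core (RPLJCore.BL5b A B C) = BL5b _ _ _
erase-core (RPLJCore.BL6 A B C) = BL6 _ _ _
erase-core (RPLJCore.BL7 A) = BL7 _
erase-core (RPLJCore.L A) = L _
erase-core (RPLJCore.TC1 r s) = TC1 r s
erase-core (RPLJCore.TC2 r s) = TC2 r s

erase-axiom : ∀ {A} → AxJ A → RPL⊢ erase A
erase-axiom (core a) = ax (erase-core a)
erase-axiom (Appl s t A B) = weaken _ _
erase-axiom (SumL s t A) = ⇒-refl _
erase-axiom (SumR s t A) = ⇒-refl _

erase-CS : ∀ (𝒞 : CS) {F} → mem 𝒞 F → RPL⊢ erase F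
erase-CS 𝒞 {F} m with shape 𝒞 F m
... | c , cs , A , _ , refl = &-intro (⇒-refl _) (⇒-refl _)

erase-sound : ∀ (𝒞 : CS) {F} → 𝒞 ⊢J F → RPL⊢ erase F
erase-sound 𝒞 (ax a) = erase-axiom a
erase-sound 𝒞 (mp p q) = mp (erase-sound 𝒞 p) (erase-sound 𝒞 q)
erase-sound 𝒞 (csr m) = erase-CS 𝒞 m

lemma16 : (𝒞 : CS) (A : PFm) → 𝒞 ⊢J emb A → RPL⊢ A
lemma16 𝒞 A p = subst RPL⊢_ (erase-emb A) (erase-sound 𝒞 p)
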